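{- In the satisfaction system of preference statements with hierarchical models, let $\Phi_1,\ldots,\Phi_n\subseteq\mathcal{L}$ be non-trivial sets of statements. There exists a middle ground for $\Phi_1,\ldots,\Phi_n$ that includes a strict or a non-strict statement if and only if some statement in the set $$\{\alpha\geq\beta\mid\alpha,\beta\in\underline{V},\ \alpha\geq\beta\text{ non-trivial}\}\cup\{\alpha>\beta\mid\alpha,\beta\in\underline{V},\ \alpha>\beta\text{ non-trivial},\ \alpha\geq\beta\text{ trivial}\}$$ satisfies (P3) and (P4).
   Context: Let $V$ be a finite set of variables; each $v\in V$ has a finite domain $\underline{v}$ with more than one element; alternatives are elements $\alpha\in\underline{V}=\prod_{v\in V}\underline{v}$, with $\alpha(v)$ the value of $v$. Let $\oplus$ be a commutative, associative operator combining values of any nonempty set of variables, and assume a total order $\geq$ on the domains and on $\oplus$-combinations of values. A hierarchical model is a non-empty sequence $\pi=(Y_1,\ldots,Y_k)$ of non-empty (not necessarily disjoint) subsets of $V$. For alternatives $\alpha,\beta$: $\alpha\succeq_\pi\beta$ iff either $\bigoplus_{y\in Y_i}\alpha(y)=\bigoplus_{y\in Y_i}\beta(y)$ for all $i$, or there is $i$ with $\bigoplus_{y\in Y_i}\alpha(y)>\bigoplus_{y\in Y_i}\beta(y)$ and equality for all $j<i$; $\alpha\succ_\pi\beta$ iff the second condition holds. The language is $\mathcal{L}=\{\alpha\geq\beta\}\cup\{\alpha>\beta\}$ over $\alpha,\beta\in\underline{V}$, with $\pi\models\alpha\geq\beta$ iff $\alpha\succeq_\pi\beta$ and $\pi\models\alpha>\beta$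 iff $\alpha\succ_\pi\beta$. For $\Phi\subseteq\mathcal{L}$: $\pi\models\Phi$ iff $\pi$ satisfies every element; $\Phi\models\Phi'$ iff every model of $\Phi$ is a model of $\Phi'$; $\Phi\equiv\Phi'$ iff mutual entailment; $\Phi$ (or a single statement) is consistent if it has a model, falsifiable if some hierarchical model does not satisfy it, non-trivial if both, trivial otherwise. Given non-trivial $\Phi_1,\ldots,\Phi_n$, $\Phi\subseteq\mathcal{L}$ is a middle ground if: (P1) $\Phi$ non-trivial; (P2) if $\bigcup_i\Phi_i$ is consistent then $\Phi\equiv\bigcup_i\Phi_i$; (P3) for each $\phi\in\Phi$, each $i$ and each $\phi_i\in\Phi_i$ some model satisfies both $\phi$ and $\phi_i$; (P4) each $\phi\in\Phi$ is entailed by some $\Phi_i$; (P5) no $\Phi'\subseteq\mathcal{L}$ satisfying (P1)–(P4) has $\Phi'\models\Phi$ and $\Phi\not\models\Phi'$. A single statement satisfies (P3)/(P4) if the set consisting of it does. -}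

module Defs where

open import Level using (0ℓ)
open import Data.Nat using (ℕ; _≤_)
open import Data.Fin using (Fin)
open import Data.Fin.Subset using (Subset; Nonempty; _∈_)
open import Data.Fin.Subset.Properties using (_∈?_)
open import Data.List using (List; []; _∷_; [_]; filter; foldr; concat; map; allFin)
open import Data.List.NonEmpty using (List⁺; toList)
open import Data.List.Relation.Unary.All using (All)
open import Data.List.Membership.Propositional using () renaming (_∈_ to _∈ₗ_)
open import Data.Maybe using (Maybe; just; nothing)
open import Data.Product using (Σ; ∃; _×_; _,_)
open import Data.Sum using (_⊎_)
open import Data.Unit using (⊤)
open import Data.Empty using (⊥)
open import Relation.Nullary using (¬_)
open import Relation.Binary using (IsStrictTotalOrder)
open import Relation.Binary.PropositionalEquality using (_≡_)
open import Function.Definitions using (Injective)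

record Setting : Set₁ where
  field
    m       : ℕ
    d       : Fin m → ℕ
    d-big   : ∀ v → 2 ≤ d v
    C       : Set
    _⊕_     : C → C → C
    ⊕-comm  : ∀ x y → (x ⊕ y) ≡ (y ⊕ x)
    ⊕-assoc : ∀ x y z → ((x ⊕ y) ⊕ z) ≡ (x ⊕ (y ⊕ z))
    _<_     : C → C → Set
    <-sto   : IsStrictTotalOrder _≡_ _<_
    val     : (v : Fin m) → Fin (d v) → C
    val-inj : ∀ v → Injective _≡_ _≡_ (val v)

module _ (S : Setting) where
  open Setting S

  Alt : Set
  Alt = (v : Fin m) → Fin (d v)

  members : Subset m → List (Fin m)
  members Y = filter (λ v → v ∈? Y) (allFin m)

  -- ⊕_{y ∈ Y} α(y); it is `just` exactly when Y is non-empty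
  combine : Subset m → Alt → Maybe C
  combine Y α = foldr step nothing (members Y)
    where
    step : Fin m → Maybe C → Maybe C
    step v nothing  = just (val v (α v))
    step v (just c) = just (val v (α v) ⊕ c)

  -- strict order on combinations (only used for non-empty Y)
  _<ᴹ_ : Maybe C → Maybe C → Set
  just x <ᴹ just y = x < y
  _      <ᴹ _      = ⊥

  record HModel : Set where
    constructor hmodel
    field
      levels   : List⁺ (Subset m)
      nonempty : All Nonempty (toList levels)

  GeqL : List (Subset m) → Alt → Alt → Set
  GeqL []       α β = ⊤
  GeqL (Y ∷ Ys) α β = (combine Y β <ᴹ combine Y α)
                    ⊎ (combine Y α ≡ combine Y β × GeqL Ys α β)

  GtL : List (Subset m) → Alt → Alt → Set
  GtL []       α β = ⊥
  GtL (Y ∷ Ys) α β = (combine Y β <ᴹ combine Y α)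
                   ⊎ (combine Y α ≡ combine Y β × GtL Ys α β)

  _⊢_⪰_ : HModel → Alt → Alt → Set
  π ⊢ α ⪰ β = GeqL (toList (HModel.levels π)) α β

  _⊢_≻_ : HModel → Alt → Alt → Set
  π ⊢ α ≻ β = GtL (toList (HModel.levels π)) α β

  data Stmt : Set where
    _≥ˢ_ : Alt → Alt → Stmt
    _>ˢ_ : Alt → Alt → Stmt

  _⊨_ : HModel → Stmt → Set
  π ⊨ (α ≥ˢ β) = π ⊢ α ⪰ β
  π ⊨ (α >ˢ β) = π ⊢ α ≻ β

  -- subsets of L (L is finite) are represented by lists enumerating them
  StmtSet : Set
  StmtSet = List Stmt

  _⊨ₛ_ : HModel → StmtSet → Set
  π ⊨ₛ Φ = All (π ⊨_) Φ

  Entails : StmtSet → StmtSet → Set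
  Entails Φ Ψ = ∀ π → π ⊨ₛ Φ → π ⊨ₛ Ψ

  Equiv : StmtSet → StmtSet → Set
  Equiv Φ Ψ = Entails Φ Ψ × Entails Ψ Φ

  Consistent : StmtSet → Set
  Consistent Φ = ∃ λ π → π ⊨ₛ Φ

  Falsifiable : StmtSet → Set
  Falsifiable Φ = ∃ λ π → ¬ (π ⊨ₛ Φ)

  NonTrivial : StmtSet → Set
  NonTrivial Φ = Consistent Φ × Falsifiable Φ

  Trivial : StmtSet → Set
  Trivial Φ = ¬ NonTrivial Φ

  module _ {n : ℕ} (Φs : Fin n → StmtSet) where

    ⋃Φ : StmtSet
    ⋃Φ = concat (map Φs (allFin n))

    P1 : StmtSet → Set
    P1 Φ = NonTrivial Φ

    P2 : StmtSet → Set
    P2 Φ = Consistent ⋃Φ → Equiv Φ ⋃Φ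

    P3 : StmtSet → Set
    P3 Φ = ∀ φ → φ ∈ₗ Φ → ∀ i → ∀ φᵢ → φᵢ ∈ₗ Φs i → Consistent (φ ∷ φᵢ ∷ [])

    P4 : StmtSet → Set
    P4 Φ = ∀ φ → φ ∈ₗ Φ → ∃ λ i → Entails (Φs i) [ φ ]

    P1-4 : StmtSet → Set
    P1-4 Φ = P1 Φ × P2 Φ × P3 Φ × P4 Φ

    P5 : StmtSet → Set
    P5 Φ = ¬ (∃ λ Φ′ → P1-4 Φ′ × Entails Φ′ Φ × ¬ Entails Φ Φ′)

    MiddleGround : StmtSet → Set
    MiddleGround Φ = P1-4 Φ × P5 Φ

  InCandidates : Stmt → Set
  InCandidates (α ≥ˢ β) = NonTrivial [ α ≥ˢ β ]
  InCandidates (α >ˢ β) = NonTrivial [ α >ˢ β ] × Trivial [ α ≥ˢ β ]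

-- A middle ground containing a candidate φ with (P3) and (P4) is obtained by greedily extending
-- {φ} to a maximal consistent set G of statements that each satisfy (P3) and (P4): by maximality G
-- entails every set of such statements sharing a model with G, which yields (P2) and (P5).
-- Conversely a middle ground is falsifiable, so it has a falsifiable member ψ, which is consistent
-- and satisfies (P3) and (P4); if ψ is α > β while α ≥ β is non-trivial, then α ≥ β inherits all
-- of this. The greedy step needs consistency to be decidable: a level of a model that strictly
-- decides none of the statements can be removed, so the search over models is finite.
module Submission where

open import Defs hiding (_<ᴹ_; _⊨_; _⊨ₛ_)
import Defs
open import Data.Nat using (ℕ; zero; suc; _<_)
open import Data.Nat.Induction using (<-wellFounded)
open import Induction.WellFounded using (Acc; acc)
open import Data.Fin using (Fin; zero; suc)
import Data.Fin.Properties as Fin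
open import Data.Fin.Subset using (Subset; Nonempty)
open import Data.Fin.Subset.Properties using (nonempty?; anySubset?)
open import Data.List using (List; []; _∷_; [_]; _++_; length; filter; foldr; map; allFin; cartesianProductWith)
open import Data.List.Properties using (foldr-cong; filter-notAll)
open import Data.List.NonEmpty using (toList) renaming (_∷_ to _∷⁺_)
open import Data.List.Relation.Unary.All as All using (All; []; _∷_)
open import Data.List.Relation.Unary.All.Properties using (all-filter; filter⁺; filter⁻; anti-mono; ¬All⇒Any¬; ¬Any⇒All¬)
open import Data.List.Relation.Unary.Any as Any using (Any; here; there)
open import Data.List.Relation.Binary.Subset.Propositional using (_⊆_)
open import Data.List.Relation.Binary.Subset.Propositional.Properties using (⊆-trans; xs⊆x∷xs; ∷⁺ʳ)
open import Data.List.Membership.Propositional using (_∈_; find)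
open import Data.List.Membership.Propositional.Properties
  using (∈-++⁺ˡ; ∈-++⁺ʳ; ∈-cartesianProductWith⁺; ∈-allFin; ∈-map⁺; ∈-map⁻; ∈-concat⁺′; ∈-concat⁻′)
open import Data.Maybe using (Maybe; just; nothing)
open import Data.Maybe.Properties using (just-injective)
open import Data.Product using (∃; _×_; _,_; proj₁; proj₂)
open import Data.Sum using (_⊎_; inj₁; inj₂)
open import Data.Empty using (⊥-elim)
open import Data.Unit using (tt)
open import Function using (_∘_)
open import Function.Bundles using (_⇔_; mk⇔)
open import Relation.Nullary using (¬_; Dec; yes; no; ¬?; contradiction)
open import Relation.Nullary.Decidable using (map′; _×-dec_; _⊎-dec_; decidable-stable)
open import Relation.Unary using (Decidable)
open import Relation.Binary using (IsStrictTotalOrder; Tri; tri<; tri≈; tri>)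
open import Relation.Binary.PropositionalEquality using (_≡_; refl; sym; trans; cong; subst₂)

consFun : ∀ {k} {d : Fin (suc k) → ℕ}
        → Fin (d zero) → ((v : Fin k) → Fin (d (suc v))) → (v : Fin (suc k)) → Fin (d v)
consFun a f zero    = a
consFun a f (suc v) = f v

allFunctions : (k : ℕ) (d : Fin k → ℕ) → List ((v : Fin k) → Fin (d v))
allFunctions zero    d = (λ ()) ∷ []
allFunctions (suc k) d = cartesianProductWith consFun (allFin (d zero)) (allFunctions k (d ∘ suc))

-- Without function extensionality the enumeration is complete only up to pointwise equality.
allFunctions-complete : ∀ k d (f : (v : Fin k) → Fin (d v))
                      → ∃ λ f′ → f′ ∈ allFunctions k d × (∀ v → f′ v ≡ f v)
allFunctions-complete zero    d f = (λ ()) , here refl , λ ()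
allFunctions-complete (suc k) d f with allFunctions-complete k (d ∘ suc) (f ∘ suc)
... | g , g∈ , g≗ = consFun (f zero) g , ∈-cartesianProductWith⁺ consFun (∈-allFin (f zero)) g∈ ,
                    λ { zero → refl ; (suc v) → g≗ v }

module Greedy {X : Set} {Good : X → Set} (good? : Decidable Good)
              {Consistent : List X → Set} (consistent? : ∀ R → Dec (Consistent R))
              (Consistent-⊆ : ∀ {R R′} → R ⊆ R′ → Consistent R′ → Consistent R) where

  extend : List X → List X → List X
  extend chosen []       = chosen
  extend chosen (x ∷ xs) with good? x ×-dec consistent? (x ∷ chosen)
  ... | yes _ = extend (x ∷ chosen) xs
  ... | no  _ = extend chosen xs

  ⊆-extend : ∀ chosen xs → chosen ⊆ extend chosen xs
  ⊆-extend chosen []       = λ x∈ → x∈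
  ⊆-extend chosen (x ∷ xs) with good? x ×-dec consistent? (x ∷ chosen)
  ... | yes _ = ⊆-trans (xs⊆x∷xs chosen x) (⊆-extend (x ∷ chosen) xs)
  ... | no  _ = ⊆-extend chosen xs

  extend-consistent : ∀ chosen xs → Consistent chosen → Consistent (extend chosen xs)
  extend-consistent chosen []       c = c
  extend-consistent chosen (x ∷ xs) c with good? x ×-dec consistent? (x ∷ chosen)
  ... | yes (_ , c′) = extend-consistent (x ∷ chosen) xs c′
  ... | no  _        = extend-consistent chosen xs c

  extend-good : ∀ chosen xs → All Good chosen → All Good (extend chosen xs)
  extend-good chosen []       g = g
  extend-good chosen (x ∷ xs) g with good? x ×-dec consistent? (x ∷ chosen)
  ... | yes (gx , _) = extend-good (x ∷ chosen) xs (gx ∷ g)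
  ... | no  _        = extend-good chosen xs g

  extend-maximal : ∀ chosen xs {x} → x ∈ xs → Good x → Consistent (x ∷ extend chosen xs)
                 → x ∈ extend chosen xs
  extend-maximal chosen (y ∷ xs) x∈ gx c with good? y ×-dec consistent? (y ∷ chosen) | x∈
  ... | yes _ | here refl = ⊆-extend (y ∷ chosen) xs (here refl)
  ... | no ¬p | here refl = contradiction (gx , Consistent-⊆ (∷⁺ʳ y (⊆-extend chosen xs)) c) ¬p
  ... | yes _ | there x∈′ = extend-maximal (y ∷ chosen) xs x∈′ gx c
  ... | no  _ | there x∈′ = extend-maximal chosen xs x∈′ gx c

module Lexicographic (S : Setting) where
  open Setting S
  open IsStrictTotalOrder <-sto using (compare; asym; irrefl)

  infix 4 _<ᴹ_ _⊨_ _⊨ₛ_ _≗_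

  _<ᴹ_ : Maybe C → Maybe C → Set
  _<ᴹ_ = Defs._<ᴹ_ S

  _⊨_ : HModel S → Stmt S → Set
  _⊨_ = Defs._⊨_ S

  _⊨ₛ_ : HModel S → StmtSet S → Set
  _⊨ₛ_ = Defs._⊨ₛ_ S

  _≗_ : Alt S → Alt S → Set
  α ≗ α′ = ∀ v → α v ≡ α′ v

  <ᴹ-asym : ∀ x y → x <ᴹ y → ¬ y <ᴹ x
  <ᴹ-asym (just a) (just b) = asym

  <ᴹ-irrefl : ∀ x → ¬ x <ᴹ x
  <ᴹ-irrefl (just a) = irrefl refl

  <ᴹ-tri-just : ∀ a b → Tri (just a <ᴹ just b) (just a ≡ just b) (just b <ᴹ just a)
  <ᴹ-tri-just a b with compare a b
  ... | tri< a<b a≢b b≮a = tri< a<b (a≢b ∘ just-injective) b≮a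
  ... | tri≈ a≮b refl b≮a = tri≈ a≮b refl b≮a
  ... | tri> a≮b a≢b b<a = tri> a≮b (a≢b ∘ just-injective) b<a

  combineStep : Alt S → Fin m → Maybe C → Maybe C
  combineStep α v nothing  = just (val v (α v))
  combineStep α v (just c) = just (val v (α v) ⊕ c)

  -- `combine` folds a step function local to its `where` block; this exposes it as `combineStep`.
  combine-foldr : ∀ Y α → combine S Y α ≡ foldr (combineStep α) nothing (members S Y)
  combine-foldr Y α = foldr-cong (λ { v nothing → refl ; v (just c) → refl }) refl (members S Y)

  combine-cong : ∀ Y {α α′} → α ≗ α′ → combine S Y α ≡ combine S Y α′
  combine-cong Y α≗α′ =
    foldr-cong (λ { v nothing  → cong (λ a → just (val v a)) (α≗α′ v)
                  ; v (just c) → cong (λ a → just (val v a ⊕ c)) (α≗α′ v) })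
               refl (members S Y)

  combineStep-tri : ∀ α β v r s → Tri (combineStep α v r <ᴹ combineStep β v s)
                                      (combineStep α v r ≡ combineStep β v s)
                                      (combineStep β v s <ᴹ combineStep α v r)
  combineStep-tri α β v nothing  nothing  = <ᴹ-tri-just _ _
  combineStep-tri α β v nothing  (just _) = <ᴹ-tri-just _ _
  combineStep-tri α β v (just _) nothing  = <ᴹ-tri-just _ _
  combineStep-tri α β v (just _) (just _) = <ᴹ-tri-just _ _

  combine-tri : ∀ Y α β → Tri (combine S Y α <ᴹ combine S Y β) (combine S Y α ≡ combine S Y β)
                              (combine S Y β <ᴹ combine S Y α)
  combine-tri Y α β rewrite combine-foldr Y α | combine-foldr Y β with members S Y
  ... | []     = tri≈ (λ ()) refl (λ ())
  ... | v ∷ vs = combineStep-tri α β v _ _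

  GeqL-cong : ∀ L {α α′ β β′} → α ≗ α′ → β ≗ β′ → GeqL S L α β → GeqL S L α′ β′
  GeqL-cong []      _   _   _                  = tt
  GeqL-cong (Y ∷ L) α≗ β≗ (inj₁ β<α)         =
    inj₁ (subst₂ _<ᴹ_ (combine-cong Y β≗) (combine-cong Y α≗) β<α)
  GeqL-cong (Y ∷ L) α≗ β≗ (inj₂ (α≡β , ge)) =
    inj₂ (trans (sym (combine-cong Y α≗)) (trans α≡β (combine-cong Y β≗)) , GeqL-cong L α≗ β≗ ge)

  GtL-cong : ∀ L {α α′ β β′} → α ≗ α′ → β ≗ β′ → GtL S L α β → GtL S L α′ β′
  GtL-cong (Y ∷ L) α≗ β≗ (inj₁ β<α)         =
    inj₁ (subst₂ _<ᴹ_ (combine-cong Y β≗) (combine-cong Y α≗) β<α)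
  GtL-cong (Y ∷ L) α≗ β≗ (inj₂ (α≡β , gt)) =
    inj₂ (trans (sym (combine-cong Y α≗)) (trans α≡β (combine-cong Y β≗)) , GtL-cong L α≗ β≗ gt)

  GtL⇒GeqL : ∀ L {α β} → GtL S L α β → GeqL S L α β
  GtL⇒GeqL (Y ∷ L) (inj₁ β<α)         = inj₁ β<α
  GtL⇒GeqL (Y ∷ L) (inj₂ (α≡β , gt)) = inj₂ (α≡β , GtL⇒GeqL L gt)

  GtL⇒¬GeqL : ∀ L {α β} → GtL S L α β → ¬ GeqL S L β α
  GtL⇒¬GeqL (Y ∷ L) {α} {β} (inj₁ β<α) (inj₁ α<β) = <ᴹ-asym (combine S Y β) _ β<α α<β
  GtL⇒¬GeqL (Y ∷ L) {α} {β} (inj₁ β<α) (inj₂ (β≡α , _)) rewrite β≡α = <ᴹ-irrefl (combine S Y α) β<α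
  GtL⇒¬GeqL (Y ∷ L) {α} {β} (inj₂ (α≡β , _)) (inj₁ α<β) rewrite α≡β = <ᴹ-irrefl (combine S Y β) α<β
  GtL⇒¬GeqL (Y ∷ L) (inj₂ (_ , gt)) (inj₂ (_ , ge)) = GtL⇒¬GeqL L gt ge

  ¬GeqL⇒GtL : ∀ L {α β} → ¬ GeqL S L β α → GtL S L α β
  ¬GeqL⇒GtL []      ¬ge = ¬ge tt
  ¬GeqL⇒GtL (Y ∷ L) {α} {β} ¬ge with combine-tri Y β α
  ... | tri< β<α _ _ = inj₁ β<α
  ... | tri≈ _ β≡α _ = inj₂ (sym β≡α , ¬GeqL⇒GtL L (λ ge → ¬ge (inj₂ (β≡α , ge))))
  ... | tri> _ _ α<β = ⊥-elim (¬ge (inj₁ α<β))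

  GeqL? : ∀ L α β → Dec (GeqL S L α β)
  GeqL? []      α β = yes tt
  GeqL? (Y ∷ L) α β with combine-tri Y β α
  ... | tri< β<α _   _   = yes (inj₁ β<α)
  ... | tri≈ β≮α β≡α _   = map′ (λ ge → inj₂ (sym β≡α , ge))
                                (λ { (inj₁ β<α) → contradiction β<α β≮α ; (inj₂ (_ , ge)) → ge })
                                (GeqL? L α β)
  ... | tri> β≮α β≢α _   = no λ { (inj₁ β<α) → β≮α β<α ; (inj₂ (α≡β , _)) → β≢α (sym α≡β) }

  negate : Stmt S → Stmt S
  negate (α ≥ˢ β) = β >ˢ α
  negate (α >ˢ β) = β ≥ˢ α

  ⊨-negate⁻ : ∀ π ψ → π ⊨ negate ψ → ¬ π ⊨ ψ
  ⊨-negate⁻ π (α ≥ˢ β) gt ge = GtL⇒¬GeqL _ gt ge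
  ⊨-negate⁻ π (α >ˢ β) ge gt = GtL⇒¬GeqL _ gt ge

  ⊨-negate⁺ : ∀ π ψ → ¬ π ⊨ ψ → π ⊨ negate ψ
  ⊨-negate⁺ π (α ≥ˢ β) ¬ge = ¬GeqL⇒GtL _ ¬ge
  ⊨-negate⁺ π (α >ˢ β) ¬gt = decidable-stable (GeqL? _ β α) (¬gt ∘ ¬GeqL⇒GtL _)

  ⊨? : ∀ π ψ → Dec (π ⊨ ψ)
  ⊨? π (α ≥ˢ β) = GeqL? _ α β
  ⊨? π (α >ˢ β) = map′ (¬GeqL⇒GtL _) (GtL⇒¬GeqL _) (¬? (GeqL? _ β α))

  infix 4 _⇒ˢ_

  _⇒ˢ_ : Stmt S → Stmt S → Set
  ψ ⇒ˢ ψ′ = ∀ π → π ⊨ ψ → π ⊨ ψ′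

  Consistent-⇒ˢ : ∀ {ψ ψ′ R} → ψ ⇒ˢ ψ′ → Consistent S (ψ ∷ R) → Consistent S (ψ′ ∷ R)
  Consistent-⇒ˢ ψ⇒ψ′ (π , s ∷ sats) = π , ψ⇒ψ′ π s ∷ sats

  Entails-⇒ˢ : ∀ {ψ ψ′ Φ} → ψ ⇒ˢ ψ′ → Entails S Φ [ ψ ] → Entails S Φ [ ψ′ ]
  Entails-⇒ˢ ψ⇒ψ′ ent π sats = ψ⇒ψ′ π (All.head (ent π sats)) ∷ []

module Enumeration (S : Setting) where
  open Setting S using (m; d)
  open Lexicographic S

  allAlts : List (Alt S)
  allAlts = allFunctions m d

  allStmts : List (Stmt S)
  allStmts = cartesianProductWith _≥ˢ_ allAlts allAlts ++ cartesianProductWith _>ˢ_ allAlts allAlts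

  allStmts-complete : ∀ ψ → ∃ λ ψ′ → ψ′ ∈ allStmts × ψ ⇒ˢ ψ′ × ψ′ ⇒ˢ ψ
  allStmts-complete (α ≥ˢ β) with allFunctions-complete m d α | allFunctions-complete m d β
  ... | α′ , α′∈ , α′≗α | β′ , β′∈ , β′≗β =
    α′ ≥ˢ β′ , ∈-++⁺ˡ (∈-cartesianProductWith⁺ _≥ˢ_ α′∈ β′∈) ,
    (λ _ → GeqL-cong _ (sym ∘ α′≗α) (sym ∘ β′≗β)) , (λ _ → GeqL-cong _ α′≗α β′≗β)
  allStmts-complete (α >ˢ β) with allFunctions-complete m d α | allFunctions-complete m d β
  ... | α′ , α′∈ , α′≗α | β′ , β′∈ , β′≗β =
    α′ >ˢ β′ , ∈-++⁺ʳ (cartesianProductWith _≥ˢ_ allAlts allAlts) (∈-cartesianProductWith⁺ _>ˢ_ α′∈ β′∈) ,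
    (λ _ → GtL-cong _ (sym ∘ α′≗α) (sym ∘ β′≗β)) , (λ _ → GtL-cong _ α′≗α β′≗β)

module Consistency (S : Setting) where
  open Setting S using (m)
  open Lexicographic S

  Sat : List (Subset m) → Stmt S → Set
  Sat L (α ≥ˢ β) = GeqL S L α β
  Sat L (α >ˢ β) = GtL S L α β

  ⊨⇒Sat : ∀ π ψ → π ⊨ ψ → Sat (toList (HModel.levels π)) ψ
  ⊨⇒Sat π (α ≥ˢ β) ge = ge
  ⊨⇒Sat π (α >ˢ β) gt = gt

  Sat⇒⊨ : ∀ π ψ → Sat (toList (HModel.levels π)) ψ → π ⊨ ψ
  Sat⇒⊨ π (α ≥ˢ β) ge = ge
  Sat⇒⊨ π (α >ˢ β) gt = gt

  lhs rhs : Stmt S → Alt S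
  lhs (α ≥ˢ β) = α
  lhs (α >ˢ β) = α
  rhs (α ≥ˢ β) = β
  rhs (α >ˢ β) = β

  Decides Ties : Subset m → Stmt S → Set
  Decides Y ψ = combine S Y (rhs ψ) <ᴹ combine S Y (lhs ψ)
  Ties    Y ψ = combine S Y (lhs ψ) ≡ combine S Y (rhs ψ)

  Admits : Subset m → Stmt S → Set
  Admits Y ψ = Decides Y ψ ⊎ Ties Y ψ

  Decides? : ∀ Y → Decidable (Decides Y)
  Decides? Y ψ with combine-tri Y (rhs ψ) (lhs ψ)
  ... | tri< d _ _ = yes d
  ... | tri≈ ¬d _ _ = no ¬d
  ... | tri> ¬d _ _ = no ¬d

  Admits? : ∀ Y → Decidable (Admits Y)
  Admits? Y ψ with combine-tri Y (lhs ψ) (rhs ψ)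
  ... | tri< _ ¬t ¬d = no λ { (inj₁ d) → ¬d d ; (inj₂ t) → ¬t t }
  ... | tri≈ _ t _   = yes (inj₂ t)
  ... | tri> _ _ d   = yes (inj₁ d)

  Sat-∷⁻ : ∀ Y L ψ → Sat (Y ∷ L) ψ → Decides Y ψ ⊎ (Ties Y ψ × Sat L ψ)
  Sat-∷⁻ Y L (α ≥ˢ β) s = s
  Sat-∷⁻ Y L (α >ˢ β) s = s

  Sat-∷⁺ : ∀ Y L ψ → Decides Y ψ ⊎ (Ties Y ψ × Sat L ψ) → Sat (Y ∷ L) ψ
  Sat-∷⁺ Y L (α ≥ˢ β) s = s
  Sat-∷⁺ Y L (α >ˢ β) s = s

  Sat⇒Admits : ∀ Y L ψ → Sat (Y ∷ L) ψ → Admits Y ψ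
  Sat⇒Admits Y L ψ s with Sat-∷⁻ Y L ψ s
  ... | inj₁ d       = inj₁ d
  ... | inj₂ (t , _) = inj₂ t

  Sat-drop : ∀ Y L ψ → ¬ Decides Y ψ → Sat (Y ∷ L) ψ → Sat L ψ
  Sat-drop Y L ψ ¬d s with Sat-∷⁻ Y L ψ s
  ... | inj₁ d       = contradiction d ¬d
  ... | inj₂ (_ , s′) = s′

  Undecided : Subset m → List (Stmt S) → List (Stmt S)
  Undecided Y = filter (¬? ∘ Decides? Y)

  Undecided-shorter : ∀ {Y R} → Any (Decides Y) R → length (Undecided Y R) < length R
  Undecided-shorter {Y} {R} d = filter-notAll (¬? ∘ Decides? Y) R (Any.map (λ d ¬d → ¬d d) d)

  All-Sat-∷⁻ : ∀ Y L R → All (Sat (Y ∷ L)) R → All (Admits Y) R × All (Sat L) (Undecided Y R)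
  All-Sat-∷⁻ Y L R sats =
    All.map (λ {ψ} → Sat⇒Admits Y L ψ) sats ,
    All.zipWith (λ {ψ} (¬d , s) → Sat-drop Y L ψ ¬d s)
                (all-filter (¬? ∘ Decides? Y) R , filter⁺ (¬? ∘ Decides? Y) sats)

  All-Sat-∷⁺ : ∀ Y L R → All (Admits Y) R → All (Sat L) (Undecided Y R) → All (Sat (Y ∷ L)) R
  All-Sat-∷⁺ Y L R admits sats = filter⁻ (Decides? Y)
    (All.map (λ {ψ} → Sat-∷⁺ Y L ψ ∘ inj₁) (all-filter (Decides? Y) R))
    (All.zipWith (λ {ψ} → tie ψ)
                 (All.zip (all-filter (¬? ∘ Decides? Y) R , filter⁺ (¬? ∘ Decides? Y) admits) , sats))
    where
    tie : ∀ ψ → (¬ Decides Y ψ × Admits Y ψ) × Sat L ψ → Sat (Y ∷ L) ψ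
    tie ψ ((¬d , inj₁ d) , _) = contradiction d ¬d
    tie ψ ((_  , inj₂ t) , s) = Sat-∷⁺ Y L ψ (inj₂ (t , s))

  -- Unlike in a hierarchical model, the list of levels may be empty.
  LevelConsistent : List (Stmt S) → Set
  LevelConsistent R = ∃ λ L → All Nonempty L × All (Sat L) R

  Peelable : List (Stmt S) → Subset m → Set
  Peelable R Y = Nonempty Y × All (Admits Y) R × LevelConsistent (Undecided Y R)

  peel : ∀ R Y → Peelable R Y → LevelConsistent R
  peel R Y (ne , admits , L , nes , sats) = Y ∷ L , ne ∷ nes , All-Sat-∷⁺ Y L R admits sats

  unpeel : ∀ R Y L → Nonempty Y → All Nonempty L → All (Sat (Y ∷ L)) R → Peelable R Y
  unpeel R Y L ne nes sats = let admits , rest = All-Sat-∷⁻ Y L R sats in ne , admits , L , nes , rest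

  Sat[]? : Decidable (Sat [])
  Sat[]? (α ≥ˢ β) = yes tt
  Sat[]? (α >ˢ β) = no λ ()

  -- Leading levels that decide nothing are dropped.
  LevelConsistent-view : ∀ R L → All Nonempty L → All (Sat L) R
                       → All (Sat []) R ⊎ ∃ λ Y → Any (Decides Y) R × Peelable R Y
  LevelConsistent-view R []      []         sats = inj₁ sats
  LevelConsistent-view R (Y ∷ L) (ne ∷ nes) sats with Any.any? (Decides? Y) R
  ... | yes d = inj₂ (Y , d , unpeel R Y L ne nes sats)
  ... | no ¬d = LevelConsistent-view R L nes
                  (All.zipWith (λ {ψ} (¬dψ , s) → Sat-drop Y L ψ ¬dψ s) (¬Any⇒All¬ R ¬d , sats))

  levelConsistent? : ∀ R → Dec (LevelConsistent R)
  levelConsistent? R₀ = go R₀ (<-wellFounded (length R₀))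
    where
    go : ∀ R → Acc _<_ (length R) → Dec (LevelConsistent R)
    go R (acc shorter) =
      map′ (λ { (inj₁ sats) → [] , [] , sats ; (inj₂ (Y , _ , p)) → peel R Y p })
           (λ (L , nes , sats) → LevelConsistent-view R L nes sats)
           (All.all? Sat[]? R ⊎-dec anySubset? step?)
      where
      step? : ∀ Y → Dec (Any (Decides Y) R × Peelable R Y)
      step? Y with Any.any? (Decides? Y) R
      ... | no ¬d = no (¬d ∘ proj₁)
      ... | yes d = map′ (d ,_) proj₂
                      (nonempty? Y ×-dec All.all? (Admits? Y) R ×-dec
                       go (Undecided Y R) (shorter (Undecided-shorter d)))

  Peelable⇒Consistent : ∀ R Y → Peelable R Y → Consistent S R
  Peelable⇒Consistent R Y (ne , admits , L , nes , sats) =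
    π , All.map (λ {ψ} → Sat⇒⊨ π ψ) (All-Sat-∷⁺ Y L R admits sats)
    where
    π : HModel S
    π = hmodel (Y ∷⁺ L) (ne ∷ nes)

  Consistent⇒Peelable : ∀ R → Consistent S R → ∃ (Peelable R)
  Consistent⇒Peelable R (π@(hmodel (Y ∷⁺ L) (ne ∷ nes)) , sats) =
    Y , unpeel R Y L ne nes (All.map (λ {ψ} → ⊨⇒Sat π ψ) sats)

  consistent? : ∀ R → Dec (Consistent S R)
  consistent? R = map′ (λ (Y , p) → Peelable⇒Consistent R Y p) (Consistent⇒Peelable R)
    (anySubset? λ Y → nonempty? Y ×-dec All.all? (Admits? Y) R ×-dec levelConsistent? (Undecided Y R))

  Entails⇒¬Consistent-negate : ∀ Φ ψ → Entails S Φ [ ψ ] → ¬ Consistent S (negate ψ ∷ Φ)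
  Entails⇒¬Consistent-negate Φ ψ ent (π , ¬ψ ∷ sats) = ⊨-negate⁻ π ψ ¬ψ (All.head (ent π sats))

  ¬Consistent-negate⇒Entails : ∀ Φ ψ → ¬ Consistent S (negate ψ ∷ Φ) → Entails S Φ [ ψ ]
  ¬Consistent-negate⇒Entails Φ ψ ¬consFun π sats =
    decidable-stable (⊨? π ψ) (λ ¬s → ¬consFun (π , ⊨-negate⁺ π ψ ¬s ∷ sats)) ∷ []

  entails? : ∀ Φ ψ → Dec (Entails S Φ [ ψ ])
  entails? Φ ψ = map′ (¬Consistent-negate⇒Entails Φ ψ) (Entails⇒¬Consistent-negate Φ ψ)
                      (¬? (consistent? (negate ψ ∷ Φ)))

  Falsifiable⇒Consistent-negate : ∀ ψ → Falsifiable S [ ψ ] → Consistent S [ negate ψ ]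
  Falsifiable⇒Consistent-negate ψ (π , ¬s) = π , ⊨-negate⁺ π ψ (λ s → ¬s (s ∷ [])) ∷ []

  Consistent-negate⇒Falsifiable : ∀ ψ → Consistent S [ negate ψ ] → Falsifiable S [ ψ ]
  Consistent-negate⇒Falsifiable ψ (π , ¬ψ ∷ []) = π , λ { (s ∷ []) → ⊨-negate⁻ π ψ ¬ψ s }

module MiddleGrounds (S : Setting) {n : ℕ} (Φs : Fin n → StmtSet S) where
  open Lexicographic S
  open Consistency S
  open Enumeration S

  Acceptable : Stmt S → Set
  Acceptable ψ = P3 S Φs [ ψ ] × P4 S Φs [ ψ ]

  acceptable : ∀ {ψ} → (∀ i {φᵢ} → φᵢ ∈ Φs i → Consistent S (ψ ∷ φᵢ ∷ []))
             → (∃ λ i → Entails S (Φs i) [ ψ ]) → Acceptable ψ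
  acceptable p3 p4 = (λ { _ (here refl) i _ → p3 i }) , (λ { _ (here refl) → p4 })

  compatible : ∀ {ψ} → Acceptable ψ → ∀ i {φᵢ} → φᵢ ∈ Φs i → Consistent S (ψ ∷ φᵢ ∷ [])
  compatible (p3 , _) i = p3 _ (here refl) i _

  entailedBy : ∀ {ψ} → Acceptable ψ → ∃ λ i → Entails S (Φs i) [ ψ ]
  entailedBy (_ , p4) = p4 _ (here refl)

  acceptable? : Decidable Acceptable
  acceptable? ψ =
    map′ (λ (p3 , p4) → acceptable (λ i → All.lookup (p3 i)) p4)
         (λ a → (λ i → All.tabulate (compatible a i)) , entailedBy a)
         (Fin.all? (λ i → All.all? (λ φᵢ → consistent? (ψ ∷ φᵢ ∷ [])) (Φs i))
          ×-dec Fin.any? (λ i → entails? (Φs i) ψ))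

  Acceptable-⇒ˢ : ∀ {ψ ψ′} → ψ ⇒ˢ ψ′ → Acceptable ψ → Acceptable ψ′
  Acceptable-⇒ˢ ψ⇒ψ′ a =
    acceptable (λ i φᵢ∈ → Consistent-⇒ˢ ψ⇒ψ′ (compatible a i φᵢ∈))
               (let i , ent = entailedBy a in i , Entails-⇒ˢ ψ⇒ψ′ ent)

  acceptable-∈ : ∀ {Φ ψ} → P3 S Φs Φ → P4 S Φs Φ → ψ ∈ Φ → Acceptable ψ
  acceptable-∈ p3 p4 ψ∈ = acceptable (λ i → p3 _ ψ∈ i _) (p4 _ ψ∈)

  ∈-⋃Φ⁺ : ∀ i {ψ} → ψ ∈ Φs i → ψ ∈ ⋃Φ S Φs
  ∈-⋃Φ⁺ i ψ∈ = ∈-concat⁺′ ψ∈ (∈-map⁺ Φs (∈-allFin i))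

  ∈-⋃Φ⁻ : ∀ {ψ} → ψ ∈ ⋃Φ S Φs → ∃ λ i → ψ ∈ Φs i
  ∈-⋃Φ⁻ ψ∈ with ∈-concat⁻′ (map Φs (allFin n)) ψ∈
  ... | _ , ψ∈Φ , Φ∈ with ∈-map⁻ Φs Φ∈
  ... | i , _ , refl = i , ψ∈Φ

  acceptable-⋃Φ : ∀ {ψ} → Consistent S (⋃Φ S Φs) → ψ ∈ ⋃Φ S Φs → Acceptable ψ
  acceptable-⋃Φ (π , sats) ψ∈ =
    acceptable (λ i φᵢ∈ → π , All.lookup sats ψ∈ ∷ All.lookup sats (∈-⋃Φ⁺ i φᵢ∈) ∷ [])
               (let i , ψ∈Φᵢ = ∈-⋃Φ⁻ ψ∈ in i , λ _ sats′ → All.lookup sats′ ψ∈Φᵢ ∷ [])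

  Entails-acceptable : ∀ {Ψ Φ} → (∀ i → Entails S Ψ (Φs i)) → All Acceptable Φ → Entails S Ψ Φ
  Entails-acceptable Ψ⊨Φs accΦ π sats =
    All.map (λ a → let i , ent = entailedBy a in All.head (ent π (Ψ⊨Φs i π sats))) accΦ

  open Greedy acceptable? consistent? (λ R⊆R′ (π , sats) → π , anti-mono R⊆R′ sats)

  module _ {φ : Stmt S} (nt : NonTrivial S [ φ ]) (aφ : Acceptable φ) where

    G : StmtSet S
    G = extend [ φ ] allStmts

    φ∈G : φ ∈ G
    φ∈G = ⊆-extend [ φ ] allStmts (here refl)

    G-acceptable : All Acceptable G
    G-acceptable = extend-good [ φ ] allStmts (aφ ∷ [])

    -- Maximality holds only up to pointwise equality of alternatives, hence the detour via allStmts.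
    G-entails-acceptable : ∀ {ψ} → Acceptable ψ → Consistent S (ψ ∷ G) → Entails S G [ ψ ]
    G-entails-acceptable {ψ} aψ c π sats =
      let ψ′ , ψ′∈ , ψ⇒ψ′ , ψ′⇒ψ = allStmts-complete ψ
          ψ′∈G = extend-maximal [ φ ] allStmts ψ′∈ (Acceptable-⇒ˢ ψ⇒ψ′ aψ) (Consistent-⇒ˢ ψ⇒ψ′ c)
      in ψ′⇒ψ π (All.lookup sats ψ′∈G) ∷ []

    G-entails : ∀ {Ψ π₀} → All Acceptable Ψ → π₀ ⊨ₛ Ψ → π₀ ⊨ₛ G → Entails S G Ψ
    G-entails {π₀ = π₀} accΨ sΨ sG π sats =
      All.tabulate λ ψ∈ →
        All.head (G-entails-acceptable (All.lookup accΨ ψ∈) (π₀ , All.lookup sΨ ψ∈ ∷ sG) π sats)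

    G-middleGround : MiddleGround S Φs G
    G-middleGround = (p1 , p2 , p3 , p4) , p5
      where
      p1 : P1 S Φs G
      p1 = let cφ , π , ¬φ = nt in
           extend-consistent [ φ ] allStmts cφ , π , λ sG → ¬φ (All.lookup sG φ∈G ∷ [])

      ⋃Φ⊨G : Entails S (⋃Φ S Φs) G
      ⋃Φ⊨G = Entails-acceptable (λ i π sats → anti-mono (∈-⋃Φ⁺ i) sats) G-acceptable

      p2 : P2 S Φs G
      p2 c@(π₀ , s₀) = G-entails (All.tabulate (acceptable-⋃Φ c)) s₀ (⋃Φ⊨G π₀ s₀) , ⋃Φ⊨G

      p3 : P3 S Φs G
      p3 ψ ψ∈ i _ = compatible (All.lookup G-acceptable ψ∈) i

      p4 : P4 S Φs G
      p4 ψ ψ∈ = entailedBy (All.lookup G-acceptable ψ∈)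

      p5 : P5 S Φs G
      p5 (Φ′ , (((π₁ , s₁) , _) , _ , q3 , q4) , Φ′⊨G , G⊭Φ′) =
        G⊭Φ′ (G-entails (All.tabulate (acceptable-∈ q3 q4)) s₁ (Φ′⊨G π₁ s₁))

  InCandidates⇒NonTrivial : ∀ φ → InCandidates S φ → NonTrivial S [ φ ]
  InCandidates⇒NonTrivial (α ≥ˢ β) nt       = nt
  InCandidates⇒NonTrivial (α >ˢ β) (nt , _) = nt

  candidate : ∀ ψ → NonTrivial S [ ψ ] → Acceptable ψ → ∃ λ φ → InCandidates S φ × Acceptable φ
  candidate (α ≥ˢ β) nt a = α ≥ˢ β , nt , a
  candidate (α >ˢ β) nt@((π , s ∷ []) , _) a with consistent? [ β >ˢ α ]
  ... | no ¬c = α >ˢ β , (nt , λ (_ , f) → ¬c (Falsifiable⇒Consistent-negate (α ≥ˢ β) f)) , a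
  ... | yes c = α ≥ˢ β , ((π , GtL⇒GeqL _ s ∷ []) , Consistent-negate⇒Falsifiable (α ≥ˢ β) c) ,
                Acceptable-⇒ˢ (λ _ → GtL⇒GeqL _) a

  middleGround⇒candidate : ∀ {Φ} → MiddleGround S Φs Φ → ∃ λ φ → InCandidates S φ × Acceptable φ
  middleGround⇒candidate ((((π₀ , s₀) , (π₁ , ¬s₁)) , _ , p3 , p4) , _) =
    let ψ , ψ∈ , ¬ψ = find (¬All⇒Any¬ (⊨? π₁) _ ¬s₁)
    in candidate ψ ((π₀ , All.lookup s₀ ψ∈ ∷ []) , π₁ , ¬ψ ∘ All.head) (acceptable-∈ p3 p4 ψ∈)

  candidate⇒middleGround : ∀ {φ} → InCandidates S φ → Acceptable φ
                         → ∃ λ Φ → MiddleGround S Φs Φ × φ ∈ Φ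
  candidate⇒middleGround {φ} cφ aφ = G nt aφ , G-middleGround nt aφ , φ∈G nt aφ
    where
    nt : NonTrivial S [ φ ]
    nt = InCandidates⇒NonTrivial φ cφ

corollary10 : (S : Setting) (n : ℕ) (Φs : Fin n → StmtSet S)
    → (∀ i → NonTrivial S (Φs i))
    → (∃ λ Φ → MiddleGround S Φs Φ × ∃ λ φ → φ ∈ Φ)
      ⇔ (∃ λ φ → InCandidates S φ × P3 S Φs [ φ ] × P4 S Φs [ φ ])
corollary10 S n Φs _ = mk⇔
  (λ (_ , mg , _) → middleGround⇒candidate mg)
  (λ (φ , cφ , aφ) → let Φ , mg , φ∈ = candidate⇒middleGround cφ aφ in Φ , mg , φ , φ∈)
  where open MiddleGrounds S Φs
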